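{- Let $G$ be a graph. If the dynamic-based temporal graph $(G,[2])$ has an Eulerian local tour $T$, then for each $i\in\{1,2\}$, the restriction of $T$ to timestamp $i$ passes through every vertex of odd degree in $G$.
   Context: The dynamic-based temporal graph $(G,[2])$ is $G$ with every edge available at times $1$ and $2$. A temporal walk is a sequence $(v_0,e_1,t_1,v_1,\dots,e_k,t_k,v_k)$ where each $e_j$ is an edge of $G$ joining $v_{j-1}$ and $v_j$, $t_j\in\{1,2\}$, and $t_1\le\dots\le t_k$. It is a local trail if no edge is traversed twice at the same time; it is a local tour if moreover $v_0=v_k$; it is Eulerian if every edge of $G$ is traversed at least once. The restriction of $T$ to timestamp $i$ is the (possibly empty) sub-walk consisting of the traversals with $t_j=i$. -}

module Defs where

open import Data.Nat using (ℕ; _%_)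
open import Data.Fin using (Fin; _≟_)
open import Data.Fin.Properties using () renaming (_≟_ to _≟F_)
open import Data.Product using (_×_; _,_; proj₁; proj₂)
open import Data.Sum using (_⊎_)
open import Data.List using (List; []; _∷_; map; length; filter; allFin)
open import Data.List.Relation.Unary.Any using (Any)
open import Data.List.Relation.Unary.Unique.Propositional using (Unique)
open import Relation.Nullary using (¬_)
open import Relation.Nullary.Decidable using (_⊎-dec_)
open import Relation.Binary.PropositionalEquality using (_≡_)

record Graph : Set where
  field
    n     : ℕ
    m     : ℕ
    ends  : Fin m → Fin n × Fin n
    noLoop : ∀ e → ¬ (proj₁ (ends e) ≡ proj₂ (ends e))
    noMulti : ∀ e f →
      (ends e ≡ ends f ⊎ (proj₁ (ends e) ≡ proj₂ (ends f) × proj₂ (ends e) ≡ proj₁ (ends f))) →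
      e ≡ f

module _ (G : Graph) where
  open Graph G

  Vertex : Set
  Vertex = Fin n

  Edge : Set
  Edge = Fin m

  Joins : Edge → Vertex → Vertex → Set
  Joins e u v = ends e ≡ (u , v) ⊎ ends e ≡ (v , u)

  degree : Vertex → ℕ
  degree v = length (filter (λ e → (proj₁ (ends e) ≟F v) ⊎-dec (proj₂ (ends e) ≟F v)) (allFin m))

data Time : Set where
  t1 t2 : Time

data _≤T_ : Time → Time → Set where
  t1≤t : ∀ {t} → t1 ≤T t
  t2≤t2 : t2 ≤T t2

module _ (G : Graph) where
  open Graph G

  record Step : Set where
    constructor step
    field
      src  : Vertex G
      edge : Edge G
      time : Time
      tgt  : Vertex G
  open Step public

  data TemporalWalkFrom : Vertex G → List Step → Set where
    nil  : ∀ {v} → TemporalWalkFrom v []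
    one  : ∀ {v} (s : Step) → src s ≡ v → Joins G (edge s) (src s) (tgt s) →
           TemporalWalkFrom v (s ∷ [])
    cons : ∀ {v} (s s' : Step) (ss : List Step) → src s ≡ v →
           Joins G (edge s) (src s) (tgt s) → time s ≤T time s' →
           TemporalWalkFrom (tgt s) (s' ∷ ss) →
           TemporalWalkFrom v (s ∷ s' ∷ ss)

  endVertex : Vertex G → List Step → Vertex G
  endVertex v [] = v
  endVertex v (s ∷ ss) = endVertex (tgt s) ss

  record TemporalWalk : Set where
    constructor walk
    field
      start : Vertex G
      steps : List Step
      valid : TemporalWalkFrom start steps
  open TemporalWalk public

  IsLocalTrail : TemporalWalk → Set
  IsLocalTrail T = Unique (map (λ s → (edge s , time s)) (steps T))

  IsLocalTour : TemporalWalk → Set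
  IsLocalTour T = IsLocalTrail T × endVertex (start T) (steps T) ≡ start T

  IsEulerian : TemporalWalk → Set
  IsEulerian T = ∀ (e : Edge G) → Any (λ s → edge s ≡ e) (steps T)

  RestrictionPassesThrough : TemporalWalk → Time → Vertex G → Set
  RestrictionPassesThrough T i v =
    Any (λ s → time s ≡ i × (src s ≡ v ⊎ tgt s ≡ v)) (steps T)

  OddDegree : Vertex G → Set
  OddDegree v = degree G v % 2 ≡ 1

{-# OPTIONS --safe #-}
module Submission where

-- Suppose the restriction of T to time i avoids an odd-degree vertex v. Then every
-- edge at v is traversed only at the other timestamp, so at most once (T is a local
-- trail) and at least once (T is Eulerian): the traversals touching v correspond
-- bijectively to the edges at v. As G has no loops, each such traversal either leaves
-- or enters v, and a closed walk leaves v exactly as often as it enters it; hence the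
-- degree of v is even.

open import Defs
open import Data.Empty using (⊥-elim)
open import Data.Fin.Properties using (_≟_)
open import Data.List using (List; [_]; []; _∷_; _++_; _∷ʳ_; map; length; filter; allFin)
open import Data.List.Properties using (filter-++; length-++; length-map; length-removeAt′)
open import Data.List.Membership.Propositional using (_∈_; _─_; find; lose)
open import Data.List.Membership.Propositional.Properties
  using (∈-map⁺; ∈-map⁻; ∈-filter⁺; ∈-filter⁻; ∈-allFin)
open import Data.List.Relation.Binary.Subset.Propositional using (_⊆_)
open import Data.List.Relation.Unary.All using (All; []; _∷_)
import Data.List.Relation.Unary.All as All
import Data.List.Relation.Unary.All.Properties as All
open import Data.List.Relation.Unary.AllPairs using ([]; _∷_)
import Data.List.Relation.Unary.AllPairs.Properties as AllPairs
open import Data.List.Relation.Unary.Any using (here; there; index; any?)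
open import Data.List.Relation.Unary.Unique.Propositional using (Unique)
open import Data.List.Relation.Unary.Unique.Propositional.Properties using (filter⁺; allFin⁺)
open import Data.Nat using (ℕ; suc; _+_; _%_; _≤_; z≤n; s≤s)
open import Data.Nat.DivMod using (m*n%n≡0)
open import Data.Nat.Properties using (≤-antisym; +-comm; +-suc; +-cancelʳ-≡; +-identityʳ; *-comm)
open import Data.Product using (_×_; _,_; proj₁; proj₂)
open import Data.Sum using (_⊎_; inj₁; inj₂; swap)
open import Function using (_∘_)
open import Relation.Nullary using (¬_; yes; no; contradiction)
open import Relation.Nullary.Decidable using (_⊎-dec_; _×-dec_)
open import Relation.Unary using (Pred; Decidable)
open import Relation.Binary.Definitions using (DecidableEquality)
open import Relation.Binary.PropositionalEquality
  using (_≡_; _≢_; refl; sym; trans; cong; cong₂; subst; module ≡-Reasoning)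

module _ {a} {A : Set a} where

  ∈-─⁺ : ∀ {x y : A} {ys} (y∈ys : y ∈ ys) → x ∈ ys → x ≢ y → x ∈ ys ─ y∈ys
  ∈-─⁺ (here refl)  (here refl)  x≢y = ⊥-elim (x≢y refl)
  ∈-─⁺ (here _)     (there x∈ys) _   = x∈ys
  ∈-─⁺ (there _)    (here x≡z)   _   = here x≡z
  ∈-─⁺ (there y∈ys) (there x∈ys) x≢y = there (∈-─⁺ y∈ys x∈ys x≢y)

  Unique⇒length≤ : ∀ {xs ys : List A} → Unique xs → xs ⊆ ys → length xs ≤ length ys
  Unique⇒length≤ {[]}     _            _     = z≤n
  Unique⇒length≤ {x ∷ xs} {ys} (x∉xs ∷ xs!) xs⊆ys =
    subst (_ ≤_) (sym (length-removeAt′ ys (index x∈ys)))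
      (s≤s (Unique⇒length≤ xs! λ z∈xs →
        ∈-─⁺ x∈ys (xs⊆ys (there z∈xs)) (λ z≡x → All.lookup x∉xs z∈xs (sym z≡x))))
    where x∈ys = xs⊆ys (here refl)

  Unique⇒length≡ : ∀ {xs ys : List A} → Unique xs → Unique ys →
                   xs ⊆ ys → ys ⊆ xs → length xs ≡ length ys
  Unique⇒length≡ xs! ys! xs⊆ys ys⊆xs =
    ≤-antisym (Unique⇒length≤ xs! xs⊆ys) (Unique⇒length≤ ys! ys⊆xs)

module _ {a p q} {A : Set a} {P : Pred A p} {Q : Pred A q} (P? : Decidable P) (Q? : Decidable Q) where

  length-filter-⊎ : ∀ {xs} → All (λ x → ¬ (P x × Q x)) xs →
    length (filter (λ x → P? x ⊎-dec Q? x) xs) ≡ length (filter P? xs) + length (filter Q? xs)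
  length-filter-⊎ {[]} [] = refl
  length-filter-⊎ {x ∷ xs} (¬Px×Qx ∷ excl) with P? x | Q? x
  ... | yes Px | yes Qx = ⊥-elim (¬Px×Qx (Px , Qx))
  ... | yes _  | no _   = cong suc (length-filter-⊎ excl)
  ... | no _   | yes _  = trans (cong suc (length-filter-⊎ excl)) (sym (+-suc _ _))
  ... | no _   | no _   = length-filter-⊎ excl

module _ {a p} {A : Set a} {P : Pred A p} (P? : Decidable P) where

  length-filter-++ : ∀ xs ys →
    length (filter P? (xs ++ ys)) ≡ length (filter P? xs) + length (filter P? ys)
  length-filter-++ xs ys = trans (cong length (filter-++ P? xs ys)) (length-++ (filter P? xs))

  ∷ʳ≡∷⇒length-filter≡ : ∀ {xs ys y} → xs ∷ʳ y ≡ y ∷ ys →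
                        length (filter P? xs) ≡ length (filter P? ys)
  ∷ʳ≡∷⇒length-filter≡ {xs} {ys} {y} eq = +-cancelʳ-≡ _ _ _ (begin
    length (filter P? xs) + length (filter P? [ y ])   ≡⟨ length-filter-++ xs [ y ] ⟨
    length (filter P? (xs ∷ʳ y))                      ≡⟨ cong (length ∘ filter P?) eq ⟩
    length (filter P? ([ y ] ++ ys))                  ≡⟨ length-filter-++ [ y ] ys ⟩
    length (filter P? [ y ]) + length (filter P? ys)  ≡⟨ +-comm _ (length (filter P? ys)) ⟩
    length (filter P? ys) + length (filter P? [ y ])  ∎)
    where open ≡-Reasoning

module _ {a b p} {A : Set a} {B : Set b} {P : Pred B p} (P? : Decidable P) (f : A → B) where

  length-filter-map : ∀ xs → length (filter P? (map f xs)) ≡ length (filter (P? ∘ f) xs)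
  length-filter-map [] = refl
  length-filter-map (x ∷ xs) with P? (f x)
  ... | yes _ = cong suc (length-filter-map xs)
  ... | no _  = length-filter-map xs

module _ {a b p} {A : Set a} {B : Set b} {P : Pred A p} (P? : Decidable P) {f : A → B} where

  Unique-map-filter⁺ : ∀ {xs} → Unique (map f xs) → Unique (map f (filter P? xs))
  Unique-map-filter⁺ xs! = AllPairs.map⁺ (AllPairs.filter⁺ P? (AllPairs.map⁻ xs!))

n+n%2≡0 : ∀ n → (n + n) % 2 ≡ 0
n+n%2≡0 n =
  trans (cong (_% 2) (trans (cong (n +_) (sym (+-identityʳ n))) (*-comm 2 n))) (m*n%n≡0 n 2)

_≟ᵗ_ : DecidableEquality Time
t1 ≟ᵗ t1 = yes refl
t1 ≟ᵗ t2 = no λ ()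
t2 ≟ᵗ t1 = no λ ()
t2 ≟ᵗ t2 = yes refl

other : Time → Time
other t1 = t2
other t2 = t1

≢⇒≡other : ∀ {t i} → t ≢ i → t ≡ other i
≢⇒≡other {t1} {t1} t≢i = ⊥-elim (t≢i refl)
≢⇒≡other {t1} {t2} _   = refl
≢⇒≡other {t2} {t1} _   = refl
≢⇒≡other {t2} {t2} t≢i = ⊥-elim (t≢i refl)

module _ (G : Graph) where
  open Graph G

  Incident : Vertex G → Edge G → Set
  Incident v e = proj₁ (ends e) ≡ v ⊎ proj₂ (ends e) ≡ v

  -- the predicate filtered in degree, so degree G v is length (filter (incident? v) (allFin m))
  incident? : (v : Vertex G) → Decidable (Incident v)
  incident? v e = (proj₁ (ends e) ≟ v) ⊎-dec (proj₂ (ends e) ≟ v)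

  Joins⇒≢ : ∀ {e a b} → Joins G e a b → a ≢ b
  Joins⇒≢ {e} joins refl with ends e | noLoop e
  Joins⇒≢ (inj₁ refl) refl | _ | noLoop = noLoop refl
  Joins⇒≢ (inj₂ refl) refl | _ | noLoop = noLoop refl

  Joins⇒Incident⇒endpoint : ∀ {e a b v} → Joins G e a b → Incident v e → a ≡ v ⊎ b ≡ v
  Joins⇒Incident⇒endpoint {e} joins incident with ends e
  Joins⇒Incident⇒endpoint (inj₁ refl) incident | _ = incident
  Joins⇒Incident⇒endpoint (inj₂ refl) incident | _ = swap incident

  Joins⇒endpoint⇒Incident : ∀ {e a b v} → Joins G e a b → a ≡ v ⊎ b ≡ v → Incident v e
  Joins⇒endpoint⇒Incident {e} joins endpoint with ends e
  Joins⇒endpoint⇒Incident (inj₁ refl) endpoint | _ = endpoint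
  Joins⇒endpoint⇒Incident (inj₂ refl) endpoint | _ = swap endpoint

  Touches : Vertex G → Step G → Set
  Touches v s = src s ≡ v ⊎ tgt s ≡ v

  touches? : (v : Vertex G) → Decidable (Touches v)
  touches? v s = (src s ≟ v) ⊎-dec (tgt s ≟ v)

  traversal : Step G → Edge G × Time
  traversal s = edge s , time s

  TemporalWalkFrom⇒All-Joins : ∀ {u ss} → TemporalWalkFrom G u ss →
                               All (λ s → Joins G (edge s) (src s) (tgt s)) ss
  TemporalWalkFrom⇒All-Joins nil                     = []
  TemporalWalkFrom⇒All-Joins (one _ _ joins)          = joins ∷ []
  TemporalWalkFrom⇒All-Joins (cons _ _ _ _ joins _ w) = joins ∷ TemporalWalkFrom⇒All-Joins w

  TemporalWalkFrom⇒sources∷ʳend≡start∷targets : ∀ {u ss} → TemporalWalkFrom G u ss →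
    map src ss ∷ʳ endVertex G u ss ≡ u ∷ map tgt ss
  TemporalWalkFrom⇒sources∷ʳend≡start∷targets nil                     = refl
  TemporalWalkFrom⇒sources∷ʳend≡start∷targets (one _ refl _)          = refl
  TemporalWalkFrom⇒sources∷ʳend≡start∷targets (cons s _ _ refl _ _ w) =
    cong (src s ∷_) (TemporalWalkFrom⇒sources∷ʳend≡start∷targets w)

  Unique-traversals⇒Unique-edges : ∀ {t ss} → All (λ s → time s ≡ t) ss →
                                   Unique (map traversal ss) → Unique (map edge ss)
  Unique-traversals⇒Unique-edges [] [] = []
  Unique-traversals⇒Unique-edges (time≡t ∷ times≡t) (s∉ ∷ ss!) =
    All.map⁺ (All.zipWith (λ (traversals≢ , time'≡t) edges≡ →
                             traversals≢ (cong₂ _,_ edges≡ (trans time≡t (sym time'≡t))))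
                          (All.map⁻ s∉ , times≡t))
    ∷ Unique-traversals⇒Unique-edges times≡t ss!

  module _ (v : Vertex G) where

    departures arrivals : List (Step G) → ℕ
    departures ss = length (filter ((_≟ v) ∘ src) ss)
    arrivals   ss = length (filter ((_≟ v) ∘ tgt) ss)

    closed-walk⇒departures≡arrivals : ∀ {u ss} → TemporalWalkFrom G u ss → endVertex G u ss ≡ u →
                                      departures ss ≡ arrivals ss
    closed-walk⇒departures≡arrivals {u} {ss} w closed = begin
      departures ss                         ≡⟨ length-filter-map (_≟ v) src ss ⟨
      length (filter (_≟ v) (map src ss))   ≡⟨ ∷ʳ≡∷⇒length-filter≡ (_≟ v) sources∷ʳu≡u∷targets ⟩
      length (filter (_≟ v) (map tgt ss))   ≡⟨ length-filter-map (_≟ v) tgt ss ⟩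
      arrivals ss                           ∎
      where
      open ≡-Reasoning
      sources∷ʳu≡u∷targets : map src ss ∷ʳ u ≡ u ∷ map tgt ss
      sources∷ʳu≡u∷targets = subst (λ x → map src ss ∷ʳ x ≡ u ∷ map tgt ss) closed
                               (TemporalWalkFrom⇒sources∷ʳend≡start∷targets w)

    length-touching≡departures+arrivals : ∀ {ss} → All (λ s → Joins G (edge s) (src s) (tgt s)) ss →
      length (filter (touches? v) ss) ≡ departures ss + arrivals ss
    length-touching≡departures+arrivals joins =
      length-filter-⊎ ((_≟ v) ∘ src) ((_≟ v) ∘ tgt)
        (All.map (λ j (src≡v , tgt≡v) → Joins⇒≢ j (trans src≡v (sym tgt≡v))) joins)

    module _ (T : TemporalWalk G) where

      touched-edges : List (Edge G)
      touched-edges = map edge (filter (touches? v) (steps T))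

      private
        joins : ∀ {s} → s ∈ steps T → Joins G (edge s) (src s) (tgt s)
        joins = All.lookup (TemporalWalkFrom⇒All-Joins (valid T))

      touched-edges⊆incident : touched-edges ⊆ filter (incident? v) (allFin m)
      touched-edges⊆incident e∈ with ∈-map⁻ edge e∈
      ... | s , s∈ , refl with ∈-filter⁻ (touches? v) s∈
      ... | s∈T , touches = ∈-filter⁺ (incident? v) (∈-allFin (edge s))
          (Joins⇒endpoint⇒Incident (joins s∈T) touches)

      Eulerian⇒incident⊆touched-edges : IsEulerian G T → filter (incident? v) (allFin m) ⊆ touched-edges
      Eulerian⇒incident⊆touched-edges euler {e} e∈ with find (euler e)
      ... | s , s∈T , refl =
        ∈-map⁺ edge (∈-filter⁺ (touches? v) s∈T
          (Joins⇒Incident⇒endpoint (joins s∈T) (proj₂ (∈-filter⁻ (incident? v) {xs = allFin m} e∈))))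

      Unique-touched-edges : ∀ {i} → IsLocalTrail G T → ¬ RestrictionPassesThrough G T i v →
                             Unique touched-edges
      Unique-touched-edges {i} trail avoids =
        Unique-traversals⇒Unique-edges (All.tabulate at-other-time)
          (Unique-map-filter⁺ (touches? v) trail)
        where
        at-other-time : ∀ {s} → s ∈ filter (touches? v) (steps T) → time s ≡ other i
        at-other-time s∈ with ∈-filter⁻ (touches? v) s∈
        ... | s∈T , touches = ≢⇒≡other (λ at-i → avoids (lose s∈T (at-i , touches)))

      avoiding-Eulerian-tour⇒degree≡departures+departures :
        ∀ {i} → IsLocalTour G T → IsEulerian G T → ¬ RestrictionPassesThrough G T i v →
        degree G v ≡ departures (steps T) + departures (steps T)
      avoiding-Eulerian-tour⇒degree≡departures+departures (trail , closed) euler avoids = begin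
        degree G v                                  ≡⟨ Unique⇒length≡ incident! touched!
                                                         (Eulerian⇒incident⊆touched-edges euler)
                                                         touched-edges⊆incident ⟩
        length touched-edges                        ≡⟨ length-map edge (filter (touches? v) (steps T)) ⟩
        length (filter (touches? v) (steps T))      ≡⟨ length-touching≡departures+arrivals
                                                         (TemporalWalkFrom⇒All-Joins (valid T)) ⟩
        departures (steps T) + arrivals (steps T)   ≡⟨ cong (departures (steps T) +_)
                                                         (closed-walk⇒departures≡arrivals (valid T) closed) ⟨
        departures (steps T) + departures (steps T) ∎
        where
        open ≡-Reasoning
        incident! = filter⁺ (incident? v) (allFin⁺ m)
        touched! = Unique-touched-edges trail avoids

lemma3 : (G : Graph) (T : TemporalWalk G) →
    IsLocalTour G T → IsEulerian G T →
    (i : Time) (v : Vertex G) → OddDegree G v →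
    RestrictionPassesThrough G T i v
lemma3 G T tour euler i v odd
  with any? (λ s → (time s ≟ᵗ i) ×-dec touches? G v s) (steps T)
... | yes passes = passes
... | no avoids  = contradiction (begin
    1                         ≡⟨ odd ⟨
    degree G v % 2            ≡⟨ cong (_% 2) degree≡d+d ⟩
    (d + d) % 2               ≡⟨ n+n%2≡0 d ⟩
    0                         ∎) λ ()
  where
  open ≡-Reasoning
  d = departures G v (steps T)
  degree≡d+d : degree G v ≡ d + d
  degree≡d+d = avoiding-Eulerian-tour⇒degree≡departures+departures G v T tour euler avoids
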